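{- Let $\mathrm{nil}\colon\mathbb{L}\to\mathbb{L}$ be a function preserving $\prec$ with behavior $\mathrm{nil}$ on $\mathbb{L}$. Let $a_1,\dots,a_k\in\mathbb{L}$ satisfy $\mathrm{Nil}(a_1,\dots,a_k)$. Then for every $p\in\{1,\dots,k-1\}$ there exists $e\in\langle\mathrm{Aut}(\mathbb{L};C)\cup\{\mathrm{nil}\}\rangle$ such that $e(a_p)=a_{p+1}$, $e(a_{p+1})=a_p$, and $e(a_i)=a_i$ for every $i\in\{1,\dots,k\}\setminus\{p,p+1\}$.
   Context: A finite rooted binary tree is a finite rooted tree in which every non-leaf vertex has exactly two children; its leaf structure is the structure on its set of leaves with the ternary relation $C$ where $C(x;yz)$ holds iff the youngest common ancestor of $y$ and $z$ is a proper descendant of the youngest common ancestor of $x,y,z$ (so $C(x;yy)$ holds whenever $x\neq y$). $(\mathbb{L};C)$ denotes the unique (up to isomorphism) countable homogeneous structure whose finite substructures are, up to isomorphism, exactly the leaf structures of finite rooted binary trees. We write $xy|z$ for $C(z;xy)$, and $a_1\dots a_m|b$ means $a_ia_j|b$ for all $i,j$. $\prec$ is a fixed linear order on $\mathbb{L}$ that is convex (whenever $xy|z$, $z$ does not lie strictly between $x$ and $y$) and such that $(\mathbb{L};C,\prec)$ is homogeneous. A function $e$ has behavior $\mathrm{nil}$ on $\mathbb{L}$ if for all $x\prec y\prec z$ we have $e(x)e(y)|e(z)$. For $k\geq2$, $\mathrm{Nil}(a_1,\dots,a_k)$ means $a_1\prec a_2\prec\dots\prec a_k$ and $a_1a_2\dots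 a_{i-1}|a_i$ for all $i\in\{2,\dots,k\}$. For $F\subseteq\mathbb{L}^{\mathbb{L}}$, $\langle F\rangle$ is the set of all finite compositions of members of $F$ (including the identity). -}

module Defs where

open import Data.Nat using (ℕ; suc; _<_; _≤_)
open import Data.Fin using (Fin; toℕ)
open import Data.List using (List; []; _∷_)
open import Data.List.Relation.Unary.All using (All)
open import Data.Product using (Σ; Σ-syntax; ∃; ∃-syntax; _×_; proj₁)
open import Data.Sum using (_⊎_)
open import Relation.Nullary using (¬_)
open import Relation.Binary.PropositionalEquality using (_≡_; _≢_)
open import Function using (id; _∘_; _⇔_; _↔_; Inverse)

data BTree : Set where
  leaf : BTree
  node : BTree → BTree → BTree

data Vtx : BTree → Set where
  root : ∀ {t} → Vtx t
  inL  : ∀ {t u} → Vtx t → Vtx (node t u)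
  inR  : ∀ {t u} → Vtx u → Vtx (node t u)

data IsLeaf : {t : BTree} → Vtx t → Set where
  leaf-root : IsLeaf {leaf} root
  leaf-L    : ∀ {t u} {v : Vtx t} → IsLeaf v → IsLeaf {node t u} (inL v)
  leaf-R    : ∀ {t u} {v : Vtx u} → IsLeaf v → IsLeaf {node t u} (inR v)

Leaf : BTree → Set
Leaf t = Σ (Vtx t) IsLeaf

-- v ⊑ w : v is a descendant of w (w is an ancestor of v), reflexive
data _⊑_ : {t : BTree} → Vtx t → Vtx t → Set where
  ⊑-root : ∀ {t} {v : Vtx t} → v ⊑ root
  ⊑-L    : ∀ {t u} {v w : Vtx t} → v ⊑ w → _⊑_ {node t u} (inL v) (inL w)
  ⊑-R    : ∀ {t u} {v w : Vtx u} → v ⊑ w → _⊑_ {node t u} (inR v) (inR w)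

_⊏_ : {t : BTree} → Vtx t → Vtx t → Set
v ⊏ w = v ⊑ w × v ≢ w

CommonAncestor : {t : BTree} → Vtx t → List (Vtx t) → Set
CommonAncestor w xs = All (_⊑ w) xs

IsYCA : {t : BTree} → Vtx t → List (Vtx t) → Set
IsYCA w xs = CommonAncestor w xs × (∀ w' → CommonAncestor w' xs → w ⊑ w')

-- LeafC t x y z  ≡  C(x;yz) in the leaf structure of t
LeafC : (t : BTree) → Leaf t → Leaf t → Leaf t → Set
LeafC t x y z =
  Σ[ u ∈ Vtx t ] Σ[ v ∈ Vtx t ]
    IsYCA u (proj₁ y ∷ proj₁ z ∷ [])
    × IsYCA v (proj₁ x ∷ proj₁ y ∷ proj₁ z ∷ [])
    × u ⊏ v

module _ {L : Set} (C : L → L → L → Set) (_≺_ : L → L → Set) where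

  InjectiveFin : ∀ {n} → (Fin n → L) → Set
  InjectiveFin f = ∀ i j → f i ≡ f j → i ≡ j

  AgeSub : Set
  AgeSub = ∀ n (f : Fin (suc n) → L) → InjectiveFin f →
    Σ[ t ∈ BTree ] Σ[ g ∈ (Fin (suc n) ↔ Leaf t) ]
      (∀ i j k → C (f i) (f j) (f k) ⇔ LeafC t (Inverse.to g i) (Inverse.to g j) (Inverse.to g k))

  AgeSup : Set
  AgeSup = ∀ t → Σ[ h ∈ (Leaf t → L) ]
    (∀ x y → h x ≡ h y → x ≡ y) ×
    (∀ x y z → LeafC t x y z ⇔ C (h x) (h y) (h z))

  IsAutC : (L → L) → Set
  IsAutC f = Σ[ g ∈ (L → L) ] (∀ x → g (f x) ≡ x) × (∀ x → f (g x) ≡ x)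
    × (∀ x y z → C x y z ⇔ C (f x) (f y) (f z))

  IsAutC≺ : (L → L) → Set
  IsAutC≺ f = IsAutC f × (∀ x y → x ≺ y ⇔ f x ≺ f y)

  HomogeneousC : Set
  HomogeneousC = ∀ n (f g : Fin n → L) → InjectiveFin f → InjectiveFin g →
    (∀ i j k → C (f i) (f j) (f k) ⇔ C (g i) (g j) (g k)) →
    Σ[ α ∈ (L → L) ] IsAutC α × (∀ i → α (f i) ≡ g i)

  HomogeneousC≺ : Set
  HomogeneousC≺ = ∀ n (f g : Fin n → L) → InjectiveFin f → InjectiveFin g →
    (∀ i j k → C (f i) (f j) (f k) ⇔ C (g i) (g j) (g k)) →
    (∀ i j → f i ≺ f j ⇔ g i ≺ g j) →
    Σ[ α ∈ (L → L) ] IsAutC≺ α × (∀ i → α (f i) ≡ g i)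

  StrictLinearOrder : Set
  StrictLinearOrder = (∀ x → ¬ (x ≺ x))
    × (∀ x y z → x ≺ y → y ≺ z → x ≺ z)
    × (∀ x y → x ≢ y → x ≺ y ⊎ y ≺ x)

  Convex : Set
  Convex = ∀ x y z → C z x y → ¬ (x ≺ z × z ≺ y) × ¬ (y ≺ z × z ≺ x)

  record IsLStructure : Set where
    field
      countable   : L ↔ ℕ
      ageSub      : AgeSub
      ageSup      : AgeSup
      homogeneous : HomogeneousC
      order       : StrictLinearOrder
      convex      : Convex
      homogeneous≺ : HomogeneousC≺

  PreservesOrder : (L → L) → Set
  PreservesOrder e = ∀ x y → x ≺ y → e x ≺ e y

  -- behaviour nil: x ≺ y ≺ z ⇒ e(x)e(y)|e(z), i.e. C(e z; e x e y)
  BehaviorNil : (L → L) → Set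
  BehaviorNil e = ∀ x y z → x ≺ y → y ≺ z → C (e z) (e x) (e y)

  -- Nil(a_1,…,a_k) with 0-based indices
  Nil : ∀ {k} → (Fin k → L) → Set
  Nil {k} a = (2 ≤ k)
    × (∀ i j → toℕ i < toℕ j → a i ≺ a j)
    × (∀ i j j' → toℕ j < toℕ i → toℕ j' < toℕ i → C (a i) (a j) (a j'))

data Gen {L : Set} (F : (L → L) → Set) : (L → L) → Set where
  gen-id   : Gen F id
  gen-comp : ∀ {f g} → F f → Gen F g → Gen F (f ∘ g)

-- Call an injective sequence x₀ … x_{k-1} a caterpillar if x_j x_l | x_i whenever j, l < i. All
-- caterpillars of length k satisfy the same C-relations, so by homogeneity any two of them are
-- related by an automorphism. With q = p + 1, build (inside a large complete binary tree, using
-- convexity) a caterpillar b ordered as b_q ≺ … ≺ b₀ ≺ b_{q+1} ≺ … ≺ b_{k-1}. If ρ reverses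
-- 0 … q and σ swaps 0 and 1, then b ∘ ρ is increasing, so nil ∘ b ∘ ρ is a caterpillar, and so
-- are a and b ∘ σ. Automorphisms β : a ↦ b, γ : nil ∘ b ∘ ρ ↦ b ∘ σ and δ : nil ∘ b ∘ ρ ↦ a
-- give e = δ ∘ nil ∘ γ ∘ nil ∘ β with e (a i) = a (ρ (σ (ρ i))), and ρ σ ρ transposes p and q.
module Submission where

open import Defs
open import Data.Nat using (ℕ; zero; suc; _<_; _≤_; _∸_; _≤?_; z≤n; s≤s)
import Data.Nat.Properties as ℕ
open import Data.Fin using (Fin; zero; suc; toℕ; fromℕ<)
import Data.Fin.Properties as Fin
open import Data.List using ([]; _∷_)
open import Data.List.Relation.Unary.All using ([]; _∷_)
open import Data.Product using (Σ-syntax; _×_; _,_; proj₁; proj₂)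
open import Data.Sum using (_⊎_; inj₁; inj₂; [_,_]′)
open import Data.Empty using (⊥; ⊥-elim)
open import Function using (id; _∘_; _⇔_; mk⇔; Equivalence; Injection; Inverse)
open import Function.Properties.Inverse using (↔⇒↣)
open import Relation.Binary.Definitions using (DecidableEquality; tri<; tri≈; tri>)
open import Relation.Nullary using (¬_; Dec; yes; no)
open import Relation.Unary using (Decidable)
open import Relation.Binary.PropositionalEquality
  using (_≡_; _≢_; refl; sym; trans; cong; subst; subst₂; module ≡-Reasoning)

-- Leaf structures of finite binary trees

⊑-refl : ∀ {t} {v : Vtx t} → v ⊑ v
⊑-refl {v = root}  = ⊑-root
⊑-refl {v = inL v} = ⊑-L ⊑-refl
⊑-refl {v = inR v} = ⊑-R ⊑-refl

⊑-trans : ∀ {t} {u v w : Vtx t} → u ⊑ v → v ⊑ w → u ⊑ w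
⊑-trans _       ⊑-root  = ⊑-root
⊑-trans (⊑-L p) (⊑-L q) = ⊑-L (⊑-trans p q)
⊑-trans (⊑-R p) (⊑-R q) = ⊑-R (⊑-trans p q)

⊑-antisym : ∀ {t} {u v : Vtx t} → u ⊑ v → v ⊑ u → u ≡ v
⊑-antisym ⊑-root  ⊑-root  = refl
⊑-antisym (⊑-L p) (⊑-L q) = cong inL (⊑-antisym p q)
⊑-antisym (⊑-R p) (⊑-R q) = cong inR (⊑-antisym p q)

ancestors-comparable : ∀ {t} {x u v : Vtx t} → x ⊑ u → x ⊑ v → u ⊑ v ⊎ v ⊑ u
ancestors-comparable ⊑-root  _       = inj₂ ⊑-root
ancestors-comparable _       ⊑-root  = inj₁ ⊑-root
ancestors-comparable (⊑-L p) (⊑-L q) with ancestors-comparable p q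
... | inj₁ r = inj₁ (⊑-L r)
... | inj₂ r = inj₂ (⊑-L r)
ancestors-comparable (⊑-R p) (⊑-R q) with ancestors-comparable p q
... | inj₁ r = inj₁ (⊑-R r)
... | inj₂ r = inj₂ (⊑-R r)

yca : ∀ {t} → Vtx t → Vtx t → Vtx t
yca (inL a) (inL b) = inL (yca a b)
yca (inR a) (inR b) = inR (yca a b)
yca _       _       = root

yca-upperˡ : ∀ {t} (a b : Vtx t) → a ⊑ yca a b
yca-upperˡ root    _       = ⊑-root
yca-upperˡ (inL a) root    = ⊑-root
yca-upperˡ (inL a) (inL b) = ⊑-L (yca-upperˡ a b)
yca-upperˡ (inL a) (inR b) = ⊑-root
yca-upperˡ (inR a) root    = ⊑-root
yca-upperˡ (inR a) (inL b) = ⊑-root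
yca-upperˡ (inR a) (inR b) = ⊑-R (yca-upperˡ a b)

yca-upperʳ : ∀ {t} (a b : Vtx t) → b ⊑ yca a b
yca-upperʳ root    _       = ⊑-root
yca-upperʳ (inL a) root    = ⊑-root
yca-upperʳ (inL a) (inL b) = ⊑-L (yca-upperʳ a b)
yca-upperʳ (inL a) (inR b) = ⊑-root
yca-upperʳ (inR a) root    = ⊑-root
yca-upperʳ (inR a) (inL b) = ⊑-root
yca-upperʳ (inR a) (inR b) = ⊑-R (yca-upperʳ a b)

yca-least : ∀ {t} {a b w : Vtx t} → a ⊑ w → b ⊑ w → yca a b ⊑ w
yca-least _       ⊑-root  = ⊑-root
yca-least (⊑-L p) (⊑-L q) = ⊑-L (yca-least p q)
yca-least (⊑-R p) (⊑-R q) = ⊑-R (yca-least p q)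

yca-comm : ∀ {t} (a b : Vtx t) → yca a b ≡ yca b a
yca-comm a b = ⊑-antisym (yca-least (yca-upperʳ b a) (yca-upperˡ b a))
                         (yca-least (yca-upperʳ a b) (yca-upperˡ a b))

isYCA-pair : ∀ {t} (a b : Vtx t) → IsYCA (yca a b) (a ∷ b ∷ [])
isYCA-pair a b = yca-upperˡ a b ∷ yca-upperʳ a b ∷ [] ,
                 λ { _ (a⊑w ∷ b⊑w ∷ []) → yca-least a⊑w b⊑w }

isYCA-triple : ∀ {t} (a b c : Vtx t) → IsYCA (yca a (yca b c)) (a ∷ b ∷ c ∷ [])
isYCA-triple a b c =
  yca-upperˡ a m ∷ ⊑-trans (yca-upperˡ b c) (yca-upperʳ a m)
                 ∷ ⊑-trans (yca-upperʳ b c) (yca-upperʳ a m) ∷ [] ,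
  λ { _ (a⊑w ∷ b⊑w ∷ c⊑w ∷ []) → yca-least a⊑w (yca-least b⊑w c⊑w) }
  where m = yca b c

isYCA-unique : ∀ {t} {u v : Vtx t} {xs} → IsYCA u xs → IsYCA v xs → u ≡ v
isYCA-unique (u-common , u-least) (v-common , v-least) =
  ⊑-antisym (u-least _ v-common) (v-least _ u-common)

Splits : ∀ {t} → Vtx t → Vtx t → Vtx t → Set
Splits x y z = yca y z ⊏ yca x (yca y z)

leafC⇔splits : ∀ {t} (x y z : Leaf t) → LeafC t x y z ⇔ Splits (proj₁ x) (proj₁ y) (proj₁ z)
leafC⇔splits (x , _) (y , _) (z , _) = mk⇔
  (λ (_ , _ , yz , xyz , u⊏v) →
     subst₂ _⊏_ (isYCA-unique yz (isYCA-pair y z)) (isYCA-unique xyz (isYCA-triple x y z)) u⊏v)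
  (λ s → _ , _ , isYCA-pair y z , isYCA-triple x y z , s)

¬splits-below : ∀ {t} {x y z : Vtx t} → x ⊑ yca y z → ¬ Splits x y z
¬splits-below x⊑m (m⊑top , m≢top) = m≢top (⊑-antisym m⊑top (yca-least x⊑m ⊑-refl))

splits-swap : ∀ {t} {x y z : Vtx t} → Splits x y z → Splits x z y
splits-swap {x = x} {y} {z} = subst (λ m → m ⊏ yca x m) (yca-comm y z)

splits-asym : ∀ {t} {x y z : Vtx t} → Splits x y z → ¬ Splits y x z
splits-asym {x = x} {y} {z} s s′ with ancestors-comparable (yca-upperʳ y z) (yca-upperʳ x z)
... | inj₁ yz⊑xz = ¬splits-below (⊑-trans (yca-upperˡ y z) yz⊑xz) s′
... | inj₂ xz⊑yz = ¬splits-below (⊑-trans (yca-upperˡ x z) xz⊑yz) s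

isLeaf-irrelevant : ∀ {t} {v : Vtx t} (p q : IsLeaf v) → p ≡ q
isLeaf-irrelevant leaf-root  leaf-root  = refl
isLeaf-irrelevant (leaf-L p) (leaf-L q) = cong leaf-L (isLeaf-irrelevant p q)
isLeaf-irrelevant (leaf-R p) (leaf-R q) = cong leaf-R (isLeaf-irrelevant p q)

leaf-minimal : ∀ {t} {v w : Vtx t} → IsLeaf w → v ⊑ w → v ≡ w
leaf-minimal {v = root} leaf-root ⊑-root = refl
leaf-minimal (leaf-L l) (⊑-L p) = cong inL (leaf-minimal l p)
leaf-minimal (leaf-R l) (⊑-R p) = cong inR (leaf-minimal l p)

splits-x-yy : ∀ {t} {x y : Leaf t} → x ≢ y → Splits (proj₁ x) (proj₁ y) (proj₁ y)
splits-x-yy {x = x , x-leaf} {y , y-leaf} x≢y =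
  subst (λ m → m ⊏ yca x m) (sym yca-idem) (yca-upperʳ x y , y≢yca)
  where
  yca-idem : yca y y ≡ y
  yca-idem = ⊑-antisym (yca-least ⊑-refl ⊑-refl) (yca-upperˡ y y)
  y≢yca : y ≢ yca x y
  y≢yca y≡m with leaf-minimal y-leaf (subst (x ⊑_) (sym y≡m) (yca-upperˡ x y))
  ... | refl = x≢y (cong (x ,_) (isLeaf-irrelevant x-leaf y-leaf))

module _ {t : BTree} where

  ¬leafC-x-xz : ∀ (x z : Leaf t) → ¬ LeafC t x x z
  ¬leafC-x-xz x z = ¬splits-below (yca-upperˡ _ _) ∘ Equivalence.to (leafC⇔splits x x z)

  ¬leafC-x-zx : ∀ (x z : Leaf t) → ¬ LeafC t x z x
  ¬leafC-x-zx x z = ¬splits-below (yca-upperʳ _ _) ∘ Equivalence.to (leafC⇔splits x z x)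

  leafC-x-yy : ∀ (x y : Leaf t) → x ≢ y → LeafC t x y y
  leafC-x-yy x y = Equivalence.from (leafC⇔splits x y y) ∘ splits-x-yy

  leafC-swap : ∀ (x y z : Leaf t) → LeafC t x y z → LeafC t x z y
  leafC-swap x y z =
    Equivalence.from (leafC⇔splits x z y) ∘ splits-swap ∘ Equivalence.to (leafC⇔splits x y z)

  leafC-asym : ∀ (x y z : Leaf t) → LeafC t x y z → ¬ LeafC t y x z
  leafC-asym x y z c c′ =
    splits-asym (Equivalence.to (leafC⇔splits x y z) c) (Equivalence.to (leafC⇔splits y x z) c′)

leftLeaf : ∀ {t u} → Leaf t → Leaf (node t u)
leftLeaf (v , p) = inL v , leaf-L p

rightLeaf : ∀ {t u} → Leaf u → Leaf (node t u)
rightLeaf (v , p) = inR v , leaf-R p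

module _ {t u : BTree} where

  inL-injective : ∀ {a b : Vtx t} → inL {u = u} a ≡ inL b → a ≡ b
  inL-injective refl = refl

  inR-injective : ∀ {a b : Vtx u} → inR {t = t} a ≡ inR b → a ≡ b
  inR-injective refl = refl

  leafC-left : ∀ (x y z : Leaf t) → LeafC t x y z →
    LeafC (node t u) (leftLeaf x) (leftLeaf y) (leftLeaf z)
  leafC-left x y z c with Equivalence.to (leafC⇔splits x y z) c
  ... | m⊑top , m≢top = Equivalence.from (leafC⇔splits (leftLeaf x) (leftLeaf y) (leftLeaf z))
                          (⊑-L m⊑top , m≢top ∘ inL-injective)

  leafC-right : ∀ (x y z : Leaf u) → LeafC u x y z →
    LeafC (node t u) (rightLeaf x) (rightLeaf y) (rightLeaf z)
  leafC-right x y z c with Equivalence.to (leafC⇔splits x y z) c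
  ... | m⊑top , m≢top = Equivalence.from (leafC⇔splits (rightLeaf x) (rightLeaf y) (rightLeaf z))
                          (⊑-R m⊑top , m≢top ∘ inR-injective)

  leafC-left-right : ∀ (x : Leaf t) (y z : Leaf u) →
    LeafC (node t u) (leftLeaf x) (rightLeaf y) (rightLeaf z)
  leafC-left-right x y z =
    Equivalence.from (leafC⇔splits (leftLeaf x) (rightLeaf y) (rightLeaf z)) (⊑-root , λ ())

  leafC-right-left : ∀ (x : Leaf u) (y z : Leaf t) →
    LeafC (node t u) (rightLeaf x) (leftLeaf y) (leftLeaf z)
  leafC-right-left x y z =
    Equivalence.from (leafC⇔splits (rightLeaf x) (leftLeaf y) (leftLeaf z)) (⊑-root , λ ())

-- Caterpillars and placed sequences

Caterpillar : ∀ {A : Set} → (A → A → A → Set) → ∀ {k} → (Fin k → A) → Set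
Caterpillar R x = ∀ i j l → toℕ j < toℕ i → toℕ l < toℕ i → R (x i) (x j) (x l)

record Beyond {A : Set} (_<′_ : A → A → Set) (P : Set) (u v : A) : Set where
  constructor beyond
  field
    below : P → u <′ v
    above : ¬ P → v <′ u

beyond-below : ∀ {A : Set} {_<′_ : A → A → Set} {P : Set} {u v : A} → P → u <′ v → Beyond _<′_ P u v
beyond-below p u<v = beyond (λ _ → u<v) (λ ¬p → ⊥-elim (¬p p))

beyond-above : ∀ {A : Set} {_<′_ : A → A → Set} {P : Set} {u v : A} → ¬ P → v <′ u → Beyond _<′_ P u v
beyond-above ¬p v<u = beyond (λ p → ⊥-elim (¬p p)) (λ _ → v<u)

Placed : ∀ {A : Set} → (A → A → Set) → (ℕ → Set) → ∀ {k} → (Fin k → A) → Set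
Placed _<′_ Below x = ∀ i j → toℕ j < toℕ i → Beyond _<′_ (Below (toℕ i)) (x i) (x j)

CaterpillarC : ∀ {k} → Fin k → Fin k → Fin k → Set
CaterpillarC i j l = (toℕ j < toℕ i × toℕ l < toℕ i) ⊎ (j ≡ l × i ≢ j)

module _ {A : Set} where

  snoc : ∀ {n} → (Fin n → A) → A → Fin (suc n) → A
  snoc {zero}  x z _       = z
  snoc {suc n} x z zero    = x zero
  snoc {suc n} x z (suc i) = snoc (x ∘ suc) z i

  snoc-< : ∀ {n} (x : Fin n → A) z (i : Fin (suc n)) (i<n : toℕ i < n) → snoc x z i ≡ x (fromℕ< i<n)
  snoc-< {suc n} x z zero    _         = refl
  snoc-< {suc n} x z (suc i) (s≤s i<n) = snoc-< (x ∘ suc) z i i<n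

  snoc-last : ∀ {n} (x : Fin n → A) z (i : Fin (suc n)) → toℕ i ≡ n → snoc x z i ≡ z
  snoc-last {zero}  x z zero    _  = refl
  snoc-last {suc n} x z (suc i) eq = snoc-last (x ∘ suc) z i (ℕ.suc-injective eq)

  private
    <-below-last : ∀ {n} {i j : Fin (suc n)} → toℕ j < toℕ i → toℕ j < n
    <-below-last {i = i} j<i = ℕ.<-≤-trans j<i (Fin.toℕ≤pred[n] i)

    fromℕ<-mono : ∀ {n} {a b} (a<n : a < n) (b<n : b < n) → a < b → toℕ (fromℕ< a<n) < toℕ (fromℕ< b<n)
    fromℕ<-mono a<n b<n = subst₂ _<_ (sym (Fin.toℕ-fromℕ< a<n)) (sym (Fin.toℕ-fromℕ< b<n))

  caterpillar-snoc : ∀ {R n} {x : Fin n → A} {z} → Caterpillar R x → (∀ j l → R z (x j) (x l)) →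
    Caterpillar R (snoc x z)
  caterpillar-snoc {x = x} {z} cx outer i j l j<i l<i
    rewrite snoc-< x z j (<-below-last j<i) | snoc-< x z l (<-below-last l<i)
    with ℕ.m≤n⇒m<n∨m≡n (Fin.toℕ≤pred[n] i)
  ... | inj₁ i<n rewrite snoc-< x z i i<n =
    cx _ _ _ (fromℕ<-mono (<-below-last j<i) i<n j<i) (fromℕ<-mono (<-below-last l<i) i<n l<i)
  ... | inj₂ i≡n rewrite snoc-last x z i i≡n = outer _ _

  placed-snoc : ∀ {B : Set} {_<′_ : B → B → Set} {Below n} (f : A → B) {x : Fin n → A} {z} →
    Placed _<′_ Below (f ∘ x) → (∀ j → Beyond _<′_ (Below n) (f z) (f (x j))) →
    Placed _<′_ Below (f ∘ snoc x z)
  placed-snoc {_<′_ = _<′_} {Below} f {x} {z} px outer i j j<i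
    rewrite snoc-< x z j (<-below-last j<i)
    with ℕ.m≤n⇒m<n∨m≡n (Fin.toℕ≤pred[n] i)
  ... | inj₁ i<n rewrite snoc-< x z i i<n =
    subst (λ m → Beyond _<′_ (Below m) (f (x i′)) (f (x j′))) (Fin.toℕ-fromℕ< i<n)
          (px i′ j′ (fromℕ<-mono (<-below-last j<i) i<n j<i))
    where
    i′ = fromℕ< i<n
    j′ = fromℕ< (<-below-last j<i)
  ... | inj₂ i≡n rewrite snoc-last x z i i≡n =
    subst (λ m → Beyond _<′_ (Below m) (f z) (f (x (fromℕ< (<-below-last j<i))))) (sym i≡n)
          (outer (fromℕ< (<-below-last j<i)))

-- Permutations of indices

module _ {k : ℕ} (q : Fin k) where

  reverseUpTo : Fin k → Fin k
  reverseUpTo i with toℕ i ≤? toℕ q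
  ... | yes _ = fromℕ< (ℕ.≤-<-trans (ℕ.m∸n≤m (toℕ q) (toℕ i)) (Fin.toℕ<n q))
  ... | no _  = i

  toℕ-reverseUpTo-≤ : ∀ {i} → toℕ i ≤ toℕ q → toℕ (reverseUpTo i) ≡ toℕ q ∸ toℕ i
  toℕ-reverseUpTo-≤ {i} i≤q with toℕ i ≤? toℕ q
  ... | yes _   = Fin.toℕ-fromℕ< _
  ... | no i≰q = ⊥-elim (i≰q i≤q)

  reverseUpTo-≰ : ∀ {i} → ¬ toℕ i ≤ toℕ q → reverseUpTo i ≡ i
  reverseUpTo-≰ {i} i≰q with toℕ i ≤? toℕ q
  ... | yes i≤q = ⊥-elim (i≰q i≤q)
  ... | no _    = refl

  reverseUpTo-≤ : ∀ {i} → toℕ i ≤ toℕ q → toℕ (reverseUpTo i) ≤ toℕ q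
  reverseUpTo-≤ {i} i≤q = subst (_≤ toℕ q) (sym (toℕ-reverseUpTo-≤ i≤q)) (ℕ.m∸n≤m (toℕ q) (toℕ i))

  reverseUpTo-involutive : ∀ i → reverseUpTo (reverseUpTo i) ≡ i
  reverseUpTo-involutive i = by-cases (toℕ i ≤? toℕ q)
    where
    open ≡-Reasoning
    by-cases : Dec (toℕ i ≤ toℕ q) → reverseUpTo (reverseUpTo i) ≡ i
    by-cases (yes i≤q) = Fin.toℕ-injective (begin
      toℕ (reverseUpTo (reverseUpTo i)) ≡⟨ toℕ-reverseUpTo-≤ (reverseUpTo-≤ i≤q) ⟩
      toℕ q ∸ toℕ (reverseUpTo i)       ≡⟨ cong (toℕ q ∸_) (toℕ-reverseUpTo-≤ i≤q) ⟩
      toℕ q ∸ (toℕ q ∸ toℕ i)           ≡⟨ ℕ.m∸[m∸n]≡n i≤q ⟩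
      toℕ i                             ∎)
    by-cases (no i≰q) = begin
      reverseUpTo (reverseUpTo i) ≡⟨ cong reverseUpTo (reverseUpTo-≰ i≰q) ⟩
      reverseUpTo i               ≡⟨ reverseUpTo-≰ i≰q ⟩
      i                           ∎

  reverseUpTo-flip : ∀ {A : Set} (f g : Fin k → A) → (∀ i → f (reverseUpTo i) ≡ g i) →
    ∀ i → f i ≡ g (reverseUpTo i)
  reverseUpTo-flip f _ f∘ρ≗g i = trans (cong f (sym (reverseUpTo-involutive i))) (f∘ρ≗g (reverseUpTo i))

swap01 : ∀ {m} → Fin (suc (suc m)) → Fin (suc (suc m))
swap01 zero          = suc zero
swap01 (suc zero)    = zero
swap01 (suc (suc i)) = suc (suc i)

swap01-fixes : ∀ {m} {i : Fin (suc (suc m))} → 2 ≤ toℕ i → swap01 i ≡ i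
swap01-fixes {i = suc (suc i)} _ = refl
swap01-fixes {i = suc zero} (s≤s ())

module _ {m} {p q : Fin (suc (suc m))} (q≡1+p : toℕ q ≡ suc (toℕ p)) where

  private
    ρ : Fin (suc (suc m)) → Fin (suc (suc m))
    ρ = reverseUpTo q

    p≤q : toℕ p ≤ toℕ q
    p≤q = subst (toℕ p ≤_) (sym q≡1+p) (ℕ.n≤1+n (toℕ p))

    ρ-p : ρ p ≡ suc zero
    ρ-p = Fin.toℕ-injective (trans (toℕ-reverseUpTo-≤ q p≤q)
                                   (trans (cong (_∸ toℕ p) q≡1+p) (ℕ.m+n∸n≡m 1 (toℕ p))))

    ρ-zero : ρ zero ≡ q
    ρ-zero = Fin.toℕ-injective (toℕ-reverseUpTo-≤ q z≤n)

    ρ-flip : ∀ {i j} → ρ i ≡ j → ρ j ≡ i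
    ρ-flip {i} refl = reverseUpTo-involutive q i

    two≤ρ : ∀ {i} → i ≢ p → i ≢ q → 2 ≤ toℕ (ρ i)
    two≤ρ {i} i≢p i≢q = by-cases (toℕ i ≤? toℕ q)
      where
      by-cases : Dec (toℕ i ≤ toℕ q) → 2 ≤ toℕ (ρ i)
      by-cases (yes i≤q) = subst (2 ≤_) (sym (toℕ-reverseUpTo-≤ q i≤q))
                                 (ℕ.m+n≤o⇒m≤o∸n 2 (subst (suc (suc (toℕ i)) ≤_) (sym q≡1+p) (s≤s i<p)))
        where
        i<q = ℕ.≤∧≢⇒< i≤q (i≢q ∘ Fin.toℕ-injective)
        i<p = ℕ.≤∧≢⇒< (ℕ.≤-pred (subst (toℕ i <_) q≡1+p i<q)) (i≢p ∘ Fin.toℕ-injective)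
      by-cases (no i≰q) = subst (λ j → 2 ≤ toℕ j) (sym (reverseUpTo-≰ q i≰q))
                                (ℕ.≤-trans (s≤s (subst (1 ≤_) (sym q≡1+p) (s≤s z≤n))) (ℕ.≰⇒> i≰q))

  conjugatedSwap-p : ρ (swap01 (ρ p)) ≡ q
  conjugatedSwap-p = trans (cong (ρ ∘ swap01) ρ-p) ρ-zero

  conjugatedSwap-q : ρ (swap01 (ρ q)) ≡ p
  conjugatedSwap-q = trans (cong (ρ ∘ swap01) (ρ-flip {zero} ρ-zero)) (ρ-flip {p} ρ-p)

  conjugatedSwap-fixes : ∀ {i} → i ≢ p → i ≢ q → ρ (swap01 (ρ i)) ≡ i
  conjugatedSwap-fixes {i} i≢p i≢q =
    trans (cong ρ (swap01-fixes (two≤ρ i≢p i≢q))) (reverseUpTo-involutive q i)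

-- Consequences of the axioms of (𝕃; C, ≺)

module _ {L : Set} {C : L → L → L → Set} {_≺_ : L → L → Set} (S : IsLStructure C _≺_) where

  open IsLStructure S

  private
    Injective : ∀ {k} → (Fin k → L) → Set
    Injective = InjectiveFin C _≺_

  _≟ᴸ_ : DecidableEquality L
  _≟ᴸ_ = ℕ.eq? (↔⇒↣ countable)

  ≺-irrefl : ∀ {x} → ¬ x ≺ x
  ≺-irrefl = proj₁ order _

  ≺-connex : ∀ {x y} → x ≢ y → x ≺ y ⊎ y ≺ x
  ≺-connex = proj₂ (proj₂ order) _ _

  ≺⇒≢ : ∀ {x y} → x ≺ y → x ≢ y
  ≺⇒≢ x≺y refl = ≺-irrefl x≺y

  beyond⇒≢ : ∀ {P x y} → Beyond _≺_ P x y → x ≢ y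
  beyond⇒≢ (beyond below above) refl = ≺-irrefl (above (≺-irrefl ∘ below))

  below-distinct⇒injective : ∀ {k} {x : Fin k → L} → (∀ i j → toℕ j < toℕ i → x i ≢ x j) → Injective x
  below-distinct⇒injective distinct i j xi≡xj with ℕ.<-cmp (toℕ i) (toℕ j)
  ... | tri< i<j _ _ = ⊥-elim (distinct j i i<j (sym xi≡xj))
  ... | tri≈ _ i≡j _ = Fin.toℕ-injective i≡j
  ... | tri> _ _ j<i = ⊥-elim (distinct i j j<i xi≡xj)

  private
    pair : L → L → Fin 2 → L
    pair x y zero    = x
    pair x y (suc _) = y

    triple : L → L → L → Fin 3 → L
    triple x y z zero          = x
    triple x y z (suc zero)    = y
    triple x y z (suc (suc _)) = z

    single-injective : ∀ {x} → Injective {1} (λ _ → x)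
    single-injective zero zero _ = refl

    pair-injective : ∀ {x y} → x ≢ y → Injective (pair x y)
    pair-injective x≢y = below-distinct⇒injective λ where
      (suc zero) zero _ → x≢y ∘ sym
      (suc zero) (suc zero) (s≤s ())

    triple-injective : ∀ {x y z} → x ≢ y → x ≢ z → y ≢ z → Injective (triple x y z)
    triple-injective x≢y x≢z y≢z = below-distinct⇒injective λ where
      (suc zero)       zero       _ → x≢y ∘ sym
      (suc (suc zero)) zero       _ → x≢z ∘ sym
      (suc (suc zero)) (suc zero) _ → y≢z ∘ sym
      (suc zero)       (suc zero) (s≤s ())
      (suc (suc zero)) (suc (suc zero)) (s≤s (s≤s ()))

  ¬C-x-xz : ∀ {x z} → ¬ C x x z
  ¬C-x-xz {x} {z} c with x ≟ᴸ z
  ... | yes refl = let _ , g , model = ageSub 0 (λ _ → x) single-injective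
                       g₀ = Inverse.to g zero
                   in ¬leafC-x-xz g₀ g₀ (Equivalence.to (model zero zero zero) c)
  ... | no x≢z   = let _ , g , model = ageSub 1 (pair x z) (pair-injective x≢z)
                   in ¬leafC-x-xz (Inverse.to g zero) (Inverse.to g (suc zero))
                        (Equivalence.to (model zero zero (suc zero)) c)

  ¬C-x-zx : ∀ {x z} → ¬ C x z x
  ¬C-x-zx {x} {z} c with x ≟ᴸ z
  ... | yes refl = let _ , g , model = ageSub 0 (λ _ → x) single-injective
                       g₀ = Inverse.to g zero
                   in ¬leafC-x-zx g₀ g₀ (Equivalence.to (model zero zero zero) c)
  ... | no x≢z   = let _ , g , model = ageSub 1 (pair x z) (pair-injective x≢z)
                   in ¬leafC-x-zx (Inverse.to g zero) (Inverse.to g (suc zero))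
                        (Equivalence.to (model zero (suc zero) zero) c)

  C-x-yy : ∀ {x y} → x ≢ y → C x y y
  C-x-yy {x} {y} x≢y =
    let _ , g , model = ageSub 1 (pair x y) (pair-injective x≢y)
    in Equivalence.from (model zero (suc zero) (suc zero))
         (leafC-x-yy (Inverse.to g zero) (Inverse.to g (suc zero))
           (x≢y ∘ cong (pair x y) ∘ Injection.injective (↔⇒↣ g)))

  C-asym : ∀ {x y z} → x ≢ y → x ≢ z → y ≢ z → C x y z → ¬ C y x z
  C-asym {x} {y} {z} x≢y x≢z y≢z c c′ =
    let _ , g , model = ageSub 2 (triple x y z) (triple-injective x≢y x≢z y≢z)
    in leafC-asym (Inverse.to g zero) (Inverse.to g (suc zero)) (Inverse.to g (suc (suc zero)))
                  (Equivalence.to (model zero (suc zero) (suc (suc zero))) c)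
                  (Equivalence.to (model (suc zero) zero (suc (suc zero))) c′)

  C-swap : ∀ {x y z} → x ≢ y → x ≢ z → y ≢ z → C x y z → C x z y
  C-swap {x} {y} {z} x≢y x≢z y≢z c =
    let _ , g , model = ageSub 2 (triple x y z) (triple-injective x≢y x≢z y≢z)
    in Equivalence.from (model zero (suc (suc zero)) (suc zero))
         (leafC-swap (Inverse.to g zero) (Inverse.to g (suc zero)) (Inverse.to g (suc (suc zero)))
           (Equivalence.to (model zero (suc zero) (suc (suc zero))) c))

  module _ {k : ℕ} {x : Fin k → L} (x-inj : Injective x) (x-cat : Caterpillar C x) where

    caterpillar-C⇒ : ∀ i j l → C (x i) (x j) (x l) → CaterpillarC i j l
    caterpillar-C⇒ i j l c with j Fin.≟ l
    ... | yes refl = inj₂ (refl , λ { refl → ¬C-x-xz c })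
    ... | no j≢l   = inj₁ outer
      where
      i≢j : i ≢ j
      i≢j refl = ¬C-x-xz c
      i≢l : i ≢ l
      i≢l refl = ¬C-x-zx c
      xi≢xj = i≢j ∘ x-inj i j
      xi≢xl = i≢l ∘ x-inj i l
      xj≢xl = j≢l ∘ x-inj j l
      ¬j-outermost : toℕ i < toℕ j → toℕ l < toℕ j → ⊥
      ¬j-outermost i<j l<j = C-asym xi≢xj xi≢xl xj≢xl c (x-cat j i l i<j l<j)
      ¬l-outermost : toℕ i < toℕ l → toℕ j < toℕ l → ⊥
      ¬l-outermost i<l j<l =
        C-asym xi≢xl xi≢xj (xj≢xl ∘ sym) (C-swap xi≢xj xi≢xl xj≢xl c) (x-cat l i j i<l j<l)
      outer : toℕ j < toℕ i × toℕ l < toℕ i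
      outer with ℕ.<-cmp (toℕ j) (toℕ i) | ℕ.<-cmp (toℕ l) (toℕ i)
      ... | tri< j<i _ _ | tri< l<i _ _ = j<i , l<i
      ... | tri≈ _ j≡i _ | _            = ⊥-elim (i≢j (Fin.toℕ-injective (sym j≡i)))
      ... | _            | tri≈ _ l≡i _ = ⊥-elim (i≢l (Fin.toℕ-injective (sym l≡i)))
      ... | tri< j<i _ _ | tri> _ _ i<l = ⊥-elim (¬l-outermost i<l (ℕ.<-trans j<i i<l))
      ... | tri> _ _ i<j | tri< l<i _ _ = ⊥-elim (¬j-outermost i<j (ℕ.<-trans l<i i<j))
      ... | tri> _ _ i<j | tri> _ _ i<l with ℕ.<-cmp (toℕ j) (toℕ l)
      ...   | tri< j<l _ _ = ⊥-elim (¬l-outermost i<l j<l)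
      ...   | tri≈ _ j≡l _ = ⊥-elim (j≢l (Fin.toℕ-injective j≡l))
      ...   | tri> _ _ l<j = ⊥-elim (¬j-outermost i<j l<j)

    caterpillar-C⇐ : ∀ {i j l} → CaterpillarC i j l → C (x i) (x j) (x l)
    caterpillar-C⇐ (inj₁ (j<i , l<i)) = x-cat _ _ _ j<i l<i
    caterpillar-C⇐ (inj₂ (refl , i≢j)) = C-x-yy (i≢j ∘ x-inj _ _)

  caterpillar-automorphism : ∀ {k} {x y : Fin k → L} →
    Injective x → Caterpillar C x → Injective y → Caterpillar C y →
    Σ[ α ∈ (L → L) ] IsAutC C _≺_ α × (∀ i → α (x i) ≡ y i)
  caterpillar-automorphism x-inj x-cat y-inj y-cat = homogeneous _ _ _ x-inj y-inj λ i j l →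
    mk⇔ (caterpillar-C⇐ y-inj y-cat ∘ caterpillar-C⇒ x-inj x-cat i j l)
        (caterpillar-C⇐ x-inj x-cat ∘ caterpillar-C⇒ y-inj y-cat i j l)

  Increasing : ∀ {k} → (Fin k → L) → Set
  Increasing x = ∀ i j → toℕ i < toℕ j → x i ≺ x j

  increasing⇒injective : ∀ {k} {x : Fin k → L} → Increasing x → Injective x
  increasing⇒injective x-incr = below-distinct⇒injective λ i j j<i → ≺⇒≢ (x-incr j i j<i) ∘ sym

  placed⇒injective : ∀ {Below k} {x : Fin k → L} → Placed _≺_ Below x → Injective x
  placed⇒injective x-placed = below-distinct⇒injective λ i j j<i → beyond⇒≢ (x-placed i j j<i)

  placed⇒reversed-increasing : ∀ {k} {x : Fin k → L} (q : Fin k) →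
    Placed _≺_ (_≤ toℕ q) x → Increasing (x ∘ reverseUpTo q)
  placed⇒reversed-increasing {x = x} q x-placed i j i<j = by-cases (toℕ i ≤? toℕ q) (toℕ j ≤? toℕ q)
    where
    by-cases : Dec (toℕ i ≤ toℕ q) → Dec (toℕ j ≤ toℕ q) → x (reverseUpTo q i) ≺ x (reverseUpTo q j)
    by-cases _ (yes j≤q) =
      Beyond.below (x-placed (reverseUpTo q i) (reverseUpTo q j) ρj<ρi) (reverseUpTo-≤ q i≤q)
      where
      i≤q = ℕ.<⇒≤ (ℕ.<-≤-trans i<j j≤q)
      ρj<ρi = subst₂ _<_ (sym (toℕ-reverseUpTo-≤ q j≤q)) (sym (toℕ-reverseUpTo-≤ q i≤q))
                     (ℕ.∸-monoʳ-< i<j j≤q)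
    by-cases (yes i≤q) (no j≰q) = subst (λ j′ → x (reverseUpTo q i) ≺ x j′) (sym (reverseUpTo-≰ q j≰q))
      (Beyond.above (x-placed j (reverseUpTo q i) (ℕ.≤-<-trans (reverseUpTo-≤ q i≤q) (ℕ.≰⇒> j≰q))) j≰q)
    by-cases (no i≰q) (no j≰q) =
      subst₂ (λ i′ j′ → x i′ ≺ x j′) (sym (reverseUpTo-≰ q i≰q)) (sym (reverseUpTo-≰ q j≰q))
        (Beyond.above (x-placed j i i<j) j≰q)

  nil-caterpillar : ∀ {nil : L → L} → PreservesOrder C _≺_ nil → BehaviorNil C _≺_ nil →
    ∀ {k} {x : Fin k → L} → Increasing x → Injective (nil ∘ x) × Caterpillar C (nil ∘ x)
  nil-caterpillar {nil} nil-mono nil-behaviour {x = x} x-incr = increasing⇒injective nil-x-incr , nil-x-cat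
    where
    nil-x-incr : Increasing (nil ∘ x)
    nil-x-incr i j i<j = nil-mono _ _ (x-incr i j i<j)
    nil-x-cat : Caterpillar C (nil ∘ x)
    nil-x-cat i j l j<i l<i with ℕ.<-cmp (toℕ j) (toℕ l)
    ... | tri< j<l _ _ = nil-behaviour _ _ _ (x-incr j l j<l) (x-incr l i l<i)
    ... | tri≈ _ j≡l _ rewrite Fin.toℕ-injective j≡l = C-x-yy (≺⇒≢ (nil-x-incr l i l<i) ∘ sym)
    ... | tri> _ _ l<j =
      C-swap (≺⇒≢ (nil-x-incr l i l<i) ∘ sym) (≺⇒≢ (nil-x-incr j i j<i) ∘ sym) (≺⇒≢ (nil-x-incr l j l<j))
        (nil-behaviour _ _ _ (x-incr l j l<j) (x-incr j i j<i))

  caterpillar-swap01 : ∀ {m} {x : Fin (suc (suc m)) → L} → Injective x → Caterpillar C x →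
    Injective (x ∘ swap01) × Caterpillar C (x ∘ swap01)
  caterpillar-swap01 {x = x} x-inj x-cat = swap01-injective , swapped-cat
    where
    swap01-involutive : ∀ i → swap01 (swap01 i) ≡ i
    swap01-involutive zero          = refl
    swap01-involutive (suc zero)    = refl
    swap01-involutive (suc (suc i)) = refl
    swap01-injective : Injective (x ∘ swap01)
    swap01-injective i j e =
      trans (sym (swap01-involutive i)) (trans (cong swap01 (x-inj _ _ e)) (swap01-involutive j))
    swap01-< : ∀ {i} j → toℕ j < suc (suc i) → toℕ (swap01 j) < suc (suc i)
    swap01-< zero          _   = s≤s (s≤s z≤n)
    swap01-< (suc zero)    _   = s≤s z≤n
    swap01-< (suc (suc j)) j<i = j<i
    swapped-cat : Caterpillar C (x ∘ swap01)
    swapped-cat (suc zero) zero zero _ _ = C-x-yy ((λ ()) ∘ x-inj zero (suc zero))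
    swapped-cat (suc (suc i)) j l j<i l<i =
      x-cat (suc (suc i)) (swap01 j) (swap01 l) (swap01-< j j<i) (swap01-< l l<i)
    swapped-cat (suc zero) (suc _) _ (s≤s ()) _
    swapped-cat (suc zero) zero (suc _) _ (s≤s ())

  convex-beyond : ∀ {P z o y} → C z o y → z ≢ y → Beyond _≺_ P z o → Beyond _≺_ P z y
  convex-beyond {z = z} {o} {y} c z≢y (beyond below above) = beyond
    (λ p → [ id , (λ y≺z → ⊥-elim (proj₂ (convex o y z c) (y≺z , below p))) ]′ (≺-connex z≢y))
    (λ ¬p → [ (λ z≺y → ⊥-elim (proj₁ (convex o y z c) (above ¬p , z≺y))) , id ]′ (≺-connex z≢y))

  completeTree : ℕ → BTree
  completeTree zero    = leaf
  completeTree (suc n) = node (completeTree n) (completeTree n)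

  someLeaf : ∀ t → Leaf t
  someLeaf leaf       = root , leaf-root
  someLeaf (node t _) = leftLeaf (someLeaf t)

  -- Recursing into one half of the complete tree and appending a leaf o′ of the other half,
  -- chosen so that h o′ lies on the required side of h o for a leaf o of the first half:
  -- by convexity, h o′ then lies on that side of the whole image of the first half.
  placed-leaf-caterpillar : ∀ {Below} → Decidable Below → ∀ n (h : Leaf (completeTree n) → L) →
    (∀ u v → h u ≡ h v → u ≡ v) → (∀ u v w → LeafC _ u v w → C (h u) (h v) (h w)) →
    Σ[ w ∈ (Fin (suc n) → Leaf (completeTree n)) ]
      Caterpillar (LeafC _) w × Placed _≺_ Below (h ∘ w)
  placed-leaf-caterpillar _ zero h _ _ =
    (λ _ → someLeaf leaf) , (λ { zero _ _ () _ }) , (λ { zero _ () })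
  placed-leaf-caterpillar {Below} Below? (suc n) h h-inj h-C =
    choose (Below? (suc n)) (≺-connex (λ e → leftLeaf≢rightLeaf (h-inj _ _ e)))
    where
    A = completeTree n
    T = completeTree (suc n)
    o = someLeaf A

    leftLeaf≢rightLeaf : ∀ {u v : Leaf A} → leftLeaf {u = A} u ≢ rightLeaf v
    leftLeaf≢rightLeaf ()

    Result = Σ[ w ∈ (Fin (suc (suc n)) → Leaf T) ] Caterpillar (LeafC T) w × Placed _≺_ Below (h ∘ w)

    grow : (lift : Leaf A → Leaf T) → (∀ u v → lift u ≡ lift v → u ≡ v) →
      (∀ u v w → LeafC A u v w → LeafC T (lift u) (lift v) (lift w)) →
      (o′ : Leaf T) → (∀ u v → LeafC T o′ (lift u) (lift v)) → (∀ u → o′ ≢ lift u) →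
      Beyond _≺_ (Below (suc n)) (h o′) (h (lift o)) → Result
    grow lift lift-inj lift-C o′ o′-outer o′-fresh o′-beyond =
      let w , w-cat , w-placed = placed-leaf-caterpillar {Below} Below? n (h ∘ lift)
                                   (λ u v → lift-inj u v ∘ h-inj _ _)
                                   (λ u v w → h-C _ _ _ ∘ lift-C u v w)
      in snoc (lift ∘ w) o′ ,
         caterpillar-snoc {R = LeafC T} (λ i j l j<i l<i → lift-C _ _ _ (w-cat i j l j<i l<i))
                          (λ j l → o′-outer (w j) (w l)) ,
         placed-snoc {Below = Below} h w-placed
           (λ j → convex-beyond (h-C _ _ _ (o′-outer o (w j))) (o′-fresh (w j) ∘ h-inj _ _) o′-beyond)

    grow-right : Beyond _≺_ (Below (suc n)) (h (leftLeaf o)) (h (rightLeaf o)) → Result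
    grow-right = grow rightLeaf (λ { (_ , _) (_ , _) refl → refl }) leafC-right (leftLeaf o)
      (leafC-left-right o) (λ _ → leftLeaf≢rightLeaf)

    grow-left : Beyond _≺_ (Below (suc n)) (h (rightLeaf o)) (h (leftLeaf o)) → Result
    grow-left = grow leftLeaf (λ { (_ , _) (_ , _) refl → refl }) leafC-left (rightLeaf o)
      (leafC-right-left o) (λ _ → leftLeaf≢rightLeaf ∘ sym)

    choose : Dec (Below (suc n)) → h (leftLeaf o) ≺ h (rightLeaf o) ⊎ h (rightLeaf o) ≺ h (leftLeaf o) → Result
    choose (yes b) (inj₁ l≺r) = grow-right (beyond-below b l≺r)
    choose (yes b) (inj₂ r≺l) = grow-left  (beyond-below b r≺l)
    choose (no ¬b) (inj₁ l≺r) = grow-left  (beyond-above ¬b l≺r)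
    choose (no ¬b) (inj₂ r≺l) = grow-right (beyond-above ¬b r≺l)

  placed-caterpillar : ∀ {Below} → Decidable Below → ∀ n →
    Σ[ x ∈ (Fin (suc n) → L) ] Injective x × Caterpillar C x × Placed _≺_ Below x
  placed-caterpillar {Below} Below? n =
    let h , h-inj , h-C = ageSup (completeTree n)
        w , w-cat , w-placed = placed-leaf-caterpillar {Below} Below? n h h-inj
                                 (λ u v w → Equivalence.to (h-C u v w))
    in h ∘ w , placed⇒injective {Below} w-placed ,
       (λ i j l j<i l<i → Equivalence.to (h-C _ _ _) (w-cat i j l j<i l<i)) , w-placed

mainTheorem5 : {L : Set} (C : L → L → L → Set) (_≺_ : L → L → Set) →
    IsLStructure C _≺_ →
    (nil : L → L) → PreservesOrder C _≺_ nil → BehaviorNil C _≺_ nil →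
    (k : ℕ) (a : Fin k → L) → Nil C _≺_ a →
    (p q : Fin k) → toℕ q ≡ suc (toℕ p) →
    Σ[ e ∈ (L → L) ]
    Gen (λ f → IsAutC C _≺_ f ⊎ (∀ x → f x ≡ nil x)) e
    × e (a p) ≡ a q
    × e (a q) ≡ a p
    × (∀ i → i ≢ p → i ≢ q → e (a i) ≡ a i)
mainTheorem5 _ _ _ _ _ _ zero          _ _ () _ _
mainTheorem5 _ _ _ _ _ _ (suc zero)    _ _ zero zero ()
mainTheorem5 C _≺_ S nil nil-mono nil-behaviour (suc (suc m)) a (_ , a-incr , a-cat) p q q≡1+p =
  let ρ = reverseUpTo q
      a-inj = increasing⇒injective S a-incr
      b , b-inj , b-cat , b-placed = placed-caterpillar S (_≤? toℕ q) (suc m)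
      nilbρ-inj , nilbρ-cat = nil-caterpillar S nil-mono nil-behaviour (placed⇒reversed-increasing S q b-placed)
      bσ-inj , bσ-cat = caterpillar-swap01 S b-inj b-cat
      β , β-aut , β-a   = caterpillar-automorphism S a-inj a-cat b-inj b-cat
      γ , γ-aut , γ-nilbρ = caterpillar-automorphism S nilbρ-inj nilbρ-cat bσ-inj bσ-cat
      δ , δ-aut , δ-nilbρ = caterpillar-automorphism S nilbρ-inj nilbρ-cat a-inj a-cat
      e = δ ∘ nil ∘ γ ∘ nil ∘ β
      e-a : ∀ i → e (a i) ≡ a (ρ (swap01 (ρ i)))
      e-a i = begin
        δ (nil (γ (nil (β (a i)))))    ≡⟨ cong (δ ∘ nil ∘ γ ∘ nil) (β-a i) ⟩
        δ (nil (γ (nil (b i))))        ≡⟨ cong (δ ∘ nil) (reverseUpTo-flip q (γ ∘ nil ∘ b) (b ∘ swap01) γ-nilbρ i) ⟩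
        δ (nil (b (swap01 (ρ i))))     ≡⟨ reverseUpTo-flip q (δ ∘ nil ∘ b) a δ-nilbρ (swap01 (ρ i)) ⟩
        a (ρ (swap01 (ρ i)))           ∎
  in e ,
     gen-comp (inj₁ δ-aut) (gen-comp (inj₂ λ _ → refl) (gen-comp (inj₁ γ-aut)
       (gen-comp (inj₂ λ _ → refl) (gen-comp (inj₁ β-aut) gen-id)))) ,
     trans (e-a p) (cong a (conjugatedSwap-p q≡1+p)) ,
     trans (e-a q) (cong a (conjugatedSwap-q q≡1+p)) ,
     λ i i≢p i≢q → trans (e-a i) (cong a (conjugatedSwap-fixes q≡1+p i≢p i≢q))
  where open ≡-Reasoning
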